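{- Let $k\ge1$ and let $G$ be a graph with $n$ vertices whose Dilworth number is $k$. Then $\mathrm{boolw}(G)\le k\log_2 n$.
   Context: Two vertices $x,y$ of $G$ are comparable if $N(y)\subseteq N[x]$ or $N(x)\subseteq N[y]$, where $N(v)$ is the open and $N[v]=N(v)\cup\{v\}$ the closed neighbourhood. The Dilworth number of $G$ is the largest number of pairwise incomparable vertices of $G$. For $A\subseteq V(G)$ write $\overline{A}=V(G)\setminus A$. A decomposition tree of $G$ is a pair $(T,\delta)$ where $T$ is a tree whose internal nodes have degree three and which has $|V(G)|$ leaves, and $\delta$ is a bijection between $V(G)$ and the leaves of $T$; each edge of $T$ defines a cut $\{A,\overline{A}\}$ given by the leaves of the two components of $T$ minus that edge. Define $\mathrm{cut\text{ - }bool}(A)=\log_2|\{S\subseteq\overline{A} : \exists X\subseteq A,\ S=\overline{A}\cap\bigcup_{x\in X}N(x)\}|$. The boolean-width of $(T,\delta)$ is the maximum of $\mathrm{cut\text{ - }bool}(A)$ over cuts given by edges of $T$, and $\mathrm{boolw}(G)$ is the minimum over all decomposition trees of $G$. -}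

module Defs where

open import Data.Nat using (ℕ; zero; suc; _≤_; _^_)
open import Data.Bool using (Bool; true; false; _∧_)
open import Data.Fin using (Fin)
open import Data.Fin.Properties using (_≟_)
open import Data.Fin.Subset using (Subset; _∩_; ∁)
open import Data.List using (List; []; _∷_; _++_; length; map; allFin; deduplicate)
open import Data.Bool.ListAction using (any)
open import Data.List.Membership.Propositional using (_∈_)
open import Data.List.Relation.Unary.Unique.Propositional using (Unique)
open import Data.List.Relation.Unary.AllPairs using (AllPairs)
open import Data.Vec using (Vec; tabulate; lookup)
import Data.Vec
import Data.Vec.Properties as VecP
import Data.Bool.Properties as BoolP
open import Data.Product using (Σ; _×_; ∃)
open import Data.Sum using (_⊎_)
open import Relation.Binary.PropositionalEquality using (_≡_)
open import Relation.Nullary using (¬_; Dec; does)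

record Graph (n : ℕ) : Set where
  field
    adj    : Fin n → Fin n → Bool
    sym    : ∀ x y → adj x y ≡ adj y x
    irrefl : ∀ x → adj x x ≡ false

module _ {n : ℕ} (G : Graph n) where
  open Graph G

  OpenNbhd⊆ClosedNbhd : Fin n → Fin n → Set
  OpenNbhd⊆ClosedNbhd y x = ∀ z → adj y z ≡ true → (z ≡ x) ⊎ (adj x z ≡ true)

  Comparable : Fin n → Fin n → Set
  Comparable x y = OpenNbhd⊆ClosedNbhd y x ⊎ OpenNbhd⊆ClosedNbhd x y

  IsIncomparableSet : List (Fin n) → Set
  IsIncomparableSet S = Unique S × AllPairs (λ x y → ¬ Comparable x y) S

  HasDilworthNumber : ℕ → Set
  HasDilworthNumber k =
    (Σ (List (Fin n)) λ S → IsIncomparableSet S × length S ≡ k)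
    × (∀ S → IsIncomparableSet S → length S ≤ k)

  nbhdUnion : Subset n → Subset n
  nbhdUnion X = tabulate λ z → any (λ x → lookup X x ∧ adj x z) (allFin n)

allSubsets : (n : ℕ) → List (Subset n)
allSubsets zero = Data.Vec.[] ∷ []
allSubsets (suc n) = map (true Data.Vec.∷_) (allSubsets n) ++ map (false Data.Vec.∷_) (allSubsets n)

subset-≟ : ∀ {n} (S T : Subset n) → Dec (S ≡ T)
subset-≟ = VecP.≡-dec BoolP._≟_

module _ {n : ℕ} (G : Graph n) where
  -- the family { Ā ∩ N(X) : X ⊆ A } without repetitions
  -- (X ranges over all subsets of A, enumerated as X' ∩ A for all X')
  unionNbhds : Subset n → List (Subset n)
  unionNbhds A =
    deduplicate subset-≟ (map (λ X → ∁ A ∩ nbhdUnion G (X ∩ A)) (allSubsets n))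

  -- 2^{cut-bool(A)} = |{ S ⊆ Ā : ∃ X ⊆ A, S = Ā ∩ N(X) }|
  expCutBool : Subset n → ℕ
  expCutBool A = length (unionNbhds A)

-- Decomposition trees, encoded as rooted full binary trees whose leaves
-- are labelled by vertices (obtained from an unrooted cubic tree by
-- subdividing an edge with a root).
data BTree (n : ℕ) : Set where
  leaf : Fin n → BTree n
  node : BTree n → BTree n → BTree n

leaves : ∀ {n} → BTree n → List (Fin n)
leaves (leaf v)   = v ∷ []
leaves (node l r) = leaves l ++ leaves r

IsDecompositionTree : ∀ {n} → BTree n → Set
IsDecompositionTree {n} t = Unique (leaves t) × (∀ v → v ∈ leaves t)

-- subtrees rooted at non-root nodes; their leaf sets are exactly the sides A
-- of the cuts {A, Ā} induced by the edges of the underlying unrooted tree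
properSubtrees : ∀ {n} → BTree n → List (BTree n)
properSubtrees (leaf _)   = []
properSubtrees (node l r) = l ∷ r ∷ properSubtrees l ++ properSubtrees r

leafSet : ∀ {n} → BTree n → Subset n
leafSet {n} t = tabulate λ v → any (λ w → does (v ≟ w)) (leaves t)

-- boolw(G) ≤ log₂ m, i.e. some decomposition tree has all cut-bool values ≤ log₂ m
-- (checked on both sides A and Ā of every cut)
BoolwAtMostLog : ∀ {n} → Graph n → ℕ → Set
BoolwAtMostLog {n} G m =
  Σ (BTree n) λ t → IsDecompositionTree t ×
    (∀ s → s ∈ properSubtrees t →
       expCutBool G (leafSet s) ≤ m × expCutBool G (∁ (leafSet s)) ≤ m)

-- Fix one side A of a cut and preorder the vertices by their neighbourhoods
-- across the cut: x ≼ y iff N(x) ∖ A ⊆ N(y).  For X ⊆ A the set Ā ∩ N(X) is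
-- already generated by a ≼-antichain M ⊆ X that dominates X.  Two vertices of A
-- that are ≼-incomparable are incomparable in G (a closed neighbourhood only adds
-- the vertex itself, which lies in A), so |M| ≤ k.  Padding M to length exactly k
-- with a vertex that sends no edge from A across the cut, every set Ā ∩ N(X) is
-- the trace of one of the n^k words of length k over V(G).  Hence
-- 2^cut-bool(A) ≤ n^k for EVERY A ⊆ V(G), so any decomposition tree witnesses
-- boolw(G) ≤ k log₂ n; we take a caterpillar.
module Submission where

open import Defs
open import Data.Nat using (ℕ; zero; suc; _≤_; _^_; _*_; _+_; _∸_; z≤n; s≤s)
open import Data.Nat.Properties using (m+[n∸m]≡n; module ≤-Reasoning)
open import Data.Bool using (Bool; true; false; _∧_)
open import Data.Bool.Properties using (∧-conicalˡ; ∧-conicalʳ; ⇔→≡; T-≡)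
import Data.Bool.Properties as Bool
open import Data.Bool.ListAction using (any)
open import Data.Fin using (Fin; zero; suc)
open import Data.Fin.Properties using (all?; any?)
open import Data.Fin.Subset using (Subset; _∩_; ∁)
open import Data.List
  using (List; []; _∷_; [_]; _++_; length; map; allFin; filter; replicate; deduplicate; cartesianProductWith)
import Data.List as List
open import Data.List.Properties using (length-++; length-map; length-replicate; length-removeAt′; length-tabulate)
open import Data.List.Membership.Propositional using (_∈_; find; lose)
open import Data.List.Membership.Propositional.Properties
  using (∈-filter⁺; ∈-filter⁻; ∈-map⁺; ∈-map⁻; ∈-++⁺ˡ; ∈-++⁻; ∈-allFin; ∈-deduplicate⁻; ∈-cartesianProductWith⁺)
open import Data.List.Relation.Binary.Subset.Propositional using (_⊆_)
open import Data.List.Relation.Unary.Any using (here; there; index; _─_)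
import Data.List.Relation.Unary.Any as Any
open import Data.List.Relation.Unary.Any.Properties using (any⁺; any⁻)
open import Data.List.Relation.Unary.All using (All; []; _∷_)
import Data.List.Relation.Unary.All as All
open import Data.List.Relation.Unary.AllPairs using (AllPairs; []; _∷_)
import Data.List.Relation.Unary.AllPairs.Properties as AllPairs
open import Data.List.Relation.Unary.Unique.Propositional using (Unique)
open import Data.List.Relation.Unary.Unique.Propositional.Properties using (allFin⁺)
open import Data.List.Relation.Unary.Unique.DecPropositional.Properties using (deduplicate-!)
open import Data.Vec using (tabulate; lookup)
import Data.Vec as Vec
open import Data.Vec.Properties using (lookup-zipWith)
open import Data.Product using (Σ; ∃; _×_; _,_; proj₁; proj₂)
open import Data.Sum using (_⊎_; inj₁; inj₂)
import Data.Sum as Sum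
open import Data.Empty using (⊥-elim)
open import Function using (_∘_; id)
open import Function.Bundles using (Equivalence; mk⇔)
open import Relation.Binary.PropositionalEquality using (_≡_; _≢_; refl; sym; trans; cong; cong₂; subst; module ≡-Reasoning)
open import Relation.Nullary using (¬_; Dec; yes; no; ¬?; _→-dec_)

∧-true⁻ : ∀ {a b} → a ∧ b ≡ true → a ≡ true × b ≡ true
∧-true⁻ {a} {b} e = ∧-conicalˡ a b e , ∧-conicalʳ a b e

∧-true⁺ : ∀ {a b} → a ≡ true → b ≡ true → a ∧ b ≡ true
∧-true⁺ ea eb = cong₂ _∧_ ea eb

true≢false : true ≢ false
true≢false ()

module _ {X : Set} (p : X → Bool) where

  -- `any p xs` holds iff some member of xs satisfies p (library `any⁻`/`any⁺`,
  -- restated with ≡ true, the form in which the graph is given).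
  any-true⁻ : ∀ xs → any p xs ≡ true → ∃ λ x → x ∈ xs × p x ≡ true
  any-true⁻ xs e with find (any⁻ p xs (Equivalence.from T-≡ e))
  ... | x , x∈xs , px = x , x∈xs , Equivalence.to T-≡ px

  any-true⁺ : ∀ {x xs} → x ∈ xs → p x ≡ true → any p xs ≡ true
  any-true⁺ x∈xs px = Equivalence.to T-≡ (any⁺ p (lose x∈xs (Equivalence.from T-≡ px)))

∁-∩-ext : ∀ {n} (A : Subset n) {f g : Fin n → Bool} →
  (∀ z → lookup A z ≡ false → f z ≡ g z) → ∁ A ∩ tabulate f ≡ ∁ A ∩ tabulate g
∁-∩-ext Vec.[]           agree = refl
∁-∩-ext (true Vec.∷ A)  agree = cong (false Vec.∷_) (∁-∩-ext A (agree ∘ suc))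
∁-∩-ext (false Vec.∷ A) agree = cong₂ Vec._∷_ (agree zero refl) (∁-∩-ext A (agree ∘ suc))

module _ {X : Set} where

  ∈-─ : ∀ {x z : X} {ys} (p : x ∈ ys) → z ∈ ys → z ≢ x → z ∈ (ys ─ p)
  ∈-─ (here refl) (here refl) z≢x = ⊥-elim (z≢x refl)
  ∈-─ (here _)    (there z∈ys) _  = z∈ys
  ∈-─ (there _)   (here refl) _   = here refl
  ∈-─ (there p)   (there z∈ys) z≢x = there (∈-─ p z∈ys z≢x)

  unique-⊆⇒length-≤ : ∀ {xs ys : List X} → Unique xs → xs ⊆ ys → length xs ≤ length ys
  unique-⊆⇒length-≤ {[]}     _           _   = z≤n
  unique-⊆⇒length-≤ {x ∷ xs} {ys} (x∉xs ∷ u) sub =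
    subst (suc (length xs) ≤_) (sym (length-removeAt′ ys (index x∈ys)))
      (s≤s (unique-⊆⇒length-≤ u sub′))
    where
    x∈ys : x ∈ ys
    x∈ys = sub (here refl)
    sub′ : xs ⊆ (ys ─ x∈ys)
    sub′ z∈xs = ∈-─ x∈ys (sub (there z∈xs)) (λ z≡x → All.lookup x∉xs z∈xs (sym z≡x))

length-cartesianProductWith : ∀ {X Y Z : Set} (f : X → Y → Z) xs ys →
  length (cartesianProductWith f xs ys) ≡ length xs * length ys
length-cartesianProductWith f []       ys = refl
length-cartesianProductWith f (x ∷ xs) ys = begin
  length (map (f x) ys ++ cartesianProductWith f xs ys)
    ≡⟨ length-++ (map (f x) ys) ⟩
  length (map (f x) ys) + length (cartesianProductWith f xs ys)
    ≡⟨ cong₂ _+_ (length-map (f x) ys) (length-cartesianProductWith f xs ys) ⟩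
  length ys + length xs * length ys ∎
  where open ≡-Reasoning

module _ {X : Set} (alphabet : List X) where

  words : ℕ → List (List X)
  words zero    = [ [] ]
  words (suc k) = cartesianProductWith _∷_ alphabet (words k)

  length-words : ∀ k → length (words k) ≡ length alphabet ^ k
  length-words zero    = refl
  length-words (suc k) =
    trans (length-cartesianProductWith _∷_ alphabet (words k))
          (cong (length alphabet *_) (length-words k))

  ∈-words : ∀ {w} → All (_∈ alphabet) w → w ∈ words (length w)
  ∈-words []           = here refl
  ∈-words (a∈ ∷ as∈)  = ∈-cartesianProductWith⁺ _∷_ a∈ (∈-words as∈)

module _ {X : Set} where

  padTo : ℕ → X → List X → List X
  padTo k filler xs = xs ++ replicate (k ∸ length xs) filler

  length-padTo : ∀ {k} filler (xs : List X) → length xs ≤ k → length (padTo k filler xs) ≡ k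
  length-padTo {k} filler xs |xs|≤k = begin
    length (xs ++ replicate (k ∸ length xs) filler)     ≡⟨ length-++ xs ⟩
    length xs + length (replicate (k ∸ length xs) filler) ≡⟨ cong (length xs +_) (length-replicate (k ∸ length xs)) ⟩
    length xs + (k ∸ length xs)                          ≡⟨ m+[n∸m]≡n |xs|≤k ⟩
    k ∎
    where open ≡-Reasoning

  ∈-replicate⁻ : ∀ {r} {y filler : X} → y ∈ replicate r filler → y ≡ filler
  ∈-replicate⁻ {suc r} (here y≡filler) = y≡filler
  ∈-replicate⁻ {suc r} (there y∈)      = ∈-replicate⁻ y∈

  ∈-padTo⁻ : ∀ {k filler y} (xs : List X) → y ∈ padTo k filler xs → y ∈ xs ⊎ y ≡ filler
  ∈-padTo⁻ xs y∈ = Sum.map₂ ∈-replicate⁻ (∈-++⁻ xs y∈)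

module Domination {X : Set} {_≼_ : X → X → Set}
  (≼-refl : ∀ {x} → x ≼ x)
  (≼-trans : ∀ {x y z} → x ≼ y → y ≼ z → x ≼ z)
  (_≼?_ : ∀ x y → Dec (x ≼ y)) where

  Incomparable : X → X → Set
  Incomparable x y = ¬ x ≼ y × ¬ y ≼ x

  record DominatingAntichain (L M : List X) : Set where
    field
      subset    : M ⊆ L
      antichain : AllPairs Incomparable M
      dominates : ∀ {x} → x ∈ L → ∃ λ m → m ∈ M × x ≼ m

  -- Adding x to L: if x lies below a member of M nothing changes; otherwise x
  -- joins M and the members of M below x leave it.
  extend : ∀ x {L M} → DominatingAntichain L M → ∃ (DominatingAntichain (x ∷ L))
  extend x {L} {M} D with Any.any? (x ≼?_) M
  ... | yes x≼M = M , record
    { subset    = there ∘ subset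
    ; antichain = antichain
    ; dominates = λ { (here refl) → find x≼M ; (there y∈L) → dominates y∈L }
    }
    where open DominatingAntichain D
  ... | no x⋠M = x ∷ survivors , record
    { subset    = λ { (here refl) → here refl ; (there m∈) → there (subset (kept m∈)) }
    ; antichain = All.tabulate incomparable-x ∷ AllPairs.filter⁺ notBelow? antichain
    ; dominates = dominates′
    }
    where
    open DominatingAntichain D
    notBelow? : ∀ m → Dec (¬ m ≼ x)
    notBelow? m = ¬? (m ≼? x)
    survivors : List X
    survivors = filter notBelow? M
    kept : ∀ {m} → m ∈ survivors → m ∈ M
    kept m∈ = proj₁ (∈-filter⁻ notBelow? {xs = M} m∈)
    incomparable-x : ∀ {m} → m ∈ survivors → Incomparable x m
    incomparable-x m∈ = (λ x≼m → x⋠M (lose (kept m∈) x≼m)) , proj₂ (∈-filter⁻ notBelow? {xs = M} m∈)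
    dominates′ : ∀ {y} → y ∈ x ∷ L → ∃ λ m → m ∈ x ∷ survivors × y ≼ m
    dominates′ (here refl) = x , here refl , ≼-refl
    dominates′ (there y∈L) with dominates y∈L
    ... | m , m∈M , y≼m with m ≼? x
    ...   | yes m≼x = x , here refl , ≼-trans y≼m m≼x
    ...   | no  m⋠x = m , there (∈-filter⁺ notBelow? m∈M m⋠x) , y≼m

  dominatingAntichain : ∀ L → ∃ (DominatingAntichain L)
  dominatingAntichain []      = [] , record { subset = λ () ; antichain = [] ; dominates = λ () }
  dominatingAntichain (x ∷ L) = extend x (proj₂ (dominatingAntichain L))

module CrossCut {n : ℕ} (G : Graph n) (A : Subset n) where
  open Graph G using (adj)

  _≼_ : Fin n → Fin n → Set
  x ≼ y = ∀ z → lookup A z ≡ false → adj x z ≡ true → adj y z ≡ true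

  ≼-refl : ∀ {x} → x ≼ x
  ≼-refl z _ xz = xz

  ≼-trans : ∀ {x y w} → x ≼ y → y ≼ w → x ≼ w
  ≼-trans x≼y y≼w z z∉A xz = y≼w z z∉A (x≼y z z∉A xz)

  _≼?_ : ∀ x y → Dec (x ≼ y)
  x ≼? y = all? λ z →
    (lookup A z Bool.≟ false) →-dec (adj x z Bool.≟ true) →-dec (adj y z Bool.≟ true)

  open Domination ≼-refl ≼-trans _≼?_ public

  -- N(y) ⊆ N[x] for x ∈ A gives y ≼ x: the extra vertex x is not outside A.
  closed⇒≼ : ∀ {x y} → lookup A x ≡ true → OpenNbhd⊆ClosedNbhd G y x → y ≼ x
  closed⇒≼ x∈A N[y]⊆N[x] z z∉A yz with N[y]⊆N[x] z yz
  ... | inj₁ refl = ⊥-elim (true≢false (trans (sym x∈A) z∉A))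
  ... | inj₂ xz   = xz

  incomparable⇒¬comparable : ∀ {x y} → lookup A x ≡ true → lookup A y ≡ true →
    Incomparable x y → ¬ Comparable G x y
  incomparable⇒¬comparable x∈A _   (_ , y⋠x) (inj₁ N[y]⊆N[x]) = y⋠x (closed⇒≼ x∈A N[y]⊆N[x])
  incomparable⇒¬comparable _   y∈A (x⋠y , _) (inj₂ N[x]⊆N[y]) = x⋠y (closed⇒≼ y∈A N[x]⊆N[y])

  antichain⇒incomparableSet : ∀ {M} → All (λ m → lookup A m ≡ true) M →
    AllPairs Incomparable M → IsIncomparableSet G M
  antichain⇒incomparableSet []           []           = [] , []
  antichain⇒incomparableSet {_ ∷ M} (x∈A ∷ M⊆A) (x∦M ∷ M∦M) =
    All.map distinct x∦M ∷ proj₁ rest ,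
    All.tabulate (λ y∈M → incomparable⇒¬comparable x∈A (All.lookup M⊆A y∈M) (All.lookup x∦M y∈M))
      ∷ proj₂ rest
    where
    rest : IsIncomparableSet G M
    rest = antichain⇒incomparableSet M⊆A M∦M
    distinct : ∀ {x y} → Incomparable x y → x ≢ y
    distinct (x⋠y , _) refl = x⋠y ≼-refl

  Silent : Fin n → Set
  Silent p = ∀ z → lookup A z ≡ false → lookup A p ∧ adj p z ≡ false

  -- Any vertex outside A is silent; if there is none, every vertex is.
  silentVertex : Fin n → ∃ Silent
  silentVertex v with any? (λ u → lookup A u Bool.≟ false)
  ... | yes (u , u∉A) = u , λ z _ → cong (_∧ adj u z) u∉A
  ... | no  A-full    = v , λ z z∉A → ⊥-elim (A-full (z , z∉A))

  trace : List (Fin n) → Subset n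
  trace s = ∁ A ∩ tabulate (λ z → any (λ y → lookup A y ∧ adj y z) s)

  trace-represents : ∀ (P : Subset n) (s : List (Fin n)) →
    (∀ {x} → lookup P x ≡ true → ∃ λ y → y ∈ s × lookup A y ≡ true × x ≼ y) →
    (∀ {y} → y ∈ s → lookup P y ≡ true ⊎ Silent y) →
    ∁ A ∩ nbhdUnion G P ≡ trace s
  trace-represents P s dominated covered = ∁-∩-ext A λ z z∉A → ⇔→≡ (mk⇔ (into z z∉A) (back z z∉A))
    where
    into : ∀ z → lookup A z ≡ false →
      any (λ x → lookup P x ∧ adj x z) (allFin n) ≡ true → any (λ y → lookup A y ∧ adj y z) s ≡ true
    into z z∉A hit with any-true⁻ _ (allFin n) hit
    ... | x , _ , x∈P∧xz with ∧-true⁻ x∈P∧xz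
    ...   | x∈P , xz with dominated x∈P
    ...     | y , y∈s , y∈A , x≼y = any-true⁺ _ y∈s (∧-true⁺ y∈A (x≼y z z∉A xz))
    back : ∀ z → lookup A z ≡ false →
      any (λ y → lookup A y ∧ adj y z) s ≡ true → any (λ x → lookup P x ∧ adj x z) (allFin n) ≡ true
    back z z∉A hit with any-true⁻ _ s hit
    ... | y , y∈s , y∈A∧yz with covered y∈s
    ...   | inj₁ y∈P    = any-true⁺ _ (∈-allFin y) (∧-true⁺ y∈P (proj₂ (∧-true⁻ y∈A∧yz)))
    ...   | inj₂ silent = ⊥-elim (true≢false (trans (sym y∈A∧yz) (silent z z∉A)))

module _ {n : ℕ} (G : Graph n) {k : ℕ}
  (dilworth≤k : ∀ S → IsIncomparableSet G S → length S ≤ k) (v : Fin n) (A : Subset n) where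
  open CrossCut G A

  representative : ∀ X →
    ∃ λ w → w ∈ words (allFin n) k × ∁ A ∩ nbhdUnion G (X ∩ A) ≡ trace w
  representative X = w , w∈words , trace-represents P w dominated covered
    where
    P : Subset n
    P = X ∩ A
    P? : ∀ x → Dec (lookup P x ≡ true)
    P? x = lookup P x Bool.≟ true
    L : List (Fin n)
    L = filter P? (allFin n)
    M : List (Fin n)
    M = proj₁ (dominatingAntichain L)
    open DominatingAntichain (proj₂ (dominatingAntichain L))
    inP : ∀ {x} → x ∈ L → lookup P x ≡ true
    inP x∈L = proj₂ (∈-filter⁻ P? {xs = allFin n} x∈L)
    inA : ∀ {x} → lookup P x ≡ true → lookup A x ≡ true
    inA {x} x∈P = proj₂ (∧-true⁻ (trans (sym (lookup-zipWith _∧_ x X A)) x∈P))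
    |M|≤k : length M ≤ k
    |M|≤k = dilworth≤k M (antichain⇒incomparableSet (All.tabulate (inA ∘ inP ∘ subset)) antichain)
    filler : Fin n
    filler = proj₁ (silentVertex v)
    w : List (Fin n)
    w = padTo k filler M
    w∈words : w ∈ words (allFin n) k
    w∈words = subst (λ j → w ∈ words (allFin n) j) (length-padTo filler M |M|≤k)
      (∈-words (allFin n) (All.tabulate λ {x} _ → ∈-allFin x))
    dominated : ∀ {x} → lookup P x ≡ true → ∃ λ y → y ∈ w × lookup A y ≡ true × x ≼ y
    dominated {x} x∈P with dominates (∈-filter⁺ P? (∈-allFin x) x∈P)
    ... | m , m∈M , x≼m = m , ∈-++⁺ˡ m∈M , inA (inP (subset m∈M)) , x≼m
    covered : ∀ {y} → y ∈ w → lookup P y ≡ true ⊎ Silent y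
    covered y∈w with ∈-padTo⁻ M y∈w
    ... | inj₁ y∈M   = inj₁ (inP (subset y∈M))
    ... | inj₂ refl  = inj₂ (proj₂ (silentVertex v))

  cutBound : expCutBool G A ≤ n ^ k
  cutBound = begin
    length (deduplicate subset-≟ cuts)          ≤⟨ unique-⊆⇒length-≤ (deduplicate-! subset-≟ cuts) cuts⊆traces ⟩
    length (map trace (words (allFin n) k))     ≡⟨ length-map trace (words (allFin n) k) ⟩
    length (words (allFin n) k)                 ≡⟨ length-words (allFin n) k ⟩
    length (allFin n) ^ k                       ≡⟨ cong (_^ k) (length-tabulate {n = n} id) ⟩
    n ^ k ∎
    where
    open ≤-Reasoning
    cuts : List (Subset n)
    cuts = map (λ X → ∁ A ∩ nbhdUnion G (X ∩ A)) (allSubsets n)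
    cuts⊆traces : deduplicate subset-≟ cuts ⊆ map trace (words (allFin n) k)
    cuts⊆traces S∈ with ∈-map⁻ _ (∈-deduplicate⁻ subset-≟ cuts S∈)
    ... | X , _ , refl with representative X
    ...   | w , w∈words , S≡trace = subst (_∈ map trace (words (allFin n) k)) (sym S≡trace) (∈-map⁺ trace w∈words)

caterpillar : ∀ {n} → Fin n → List (Fin n) → BTree n
caterpillar x []       = leaf x
caterpillar x (y ∷ ys) = node (leaf x) (caterpillar y ys)

leaves-caterpillar : ∀ {n} (x : Fin n) ys → leaves (caterpillar x ys) ≡ x ∷ ys
leaves-caterpillar x []       = refl
leaves-caterpillar x (y ∷ ys) = cong (x ∷_) (leaves-caterpillar y ys)

decompositionTree : ∀ m → Σ (BTree (suc m)) IsDecompositionTree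
decompositionTree m =
  t , subst Unique (sym t-leaves) (allFin⁺ (suc m)) , λ v → subst (v ∈_) (sym t-leaves) (∈-allFin v)
  where
  t : BTree (suc m)
  t = caterpillar zero (List.tabulate suc)
  t-leaves : leaves t ≡ allFin (suc m)
  t-leaves = leaves-caterpillar zero (List.tabulate suc)

-- The theorem: boolw(G) ≤ k log₂ n, i.e. some decomposition tree has every
-- cut of size at most n^k.  A graph with no vertices has Dilworth number 0.
mainTheorem8 : (n : ℕ) (G : Graph n) (k : ℕ) → 1 ≤ k →
    HasDilworthNumber G k → BoolwAtMostLog G (n ^ k)
mainTheorem8 zero    G (suc k) _ (([] , _ , ()) , _)
mainTheorem8 zero    G (suc k) _ ((() ∷ _ , _) , _)
mainTheorem8 (suc m) G k       _ (_ , dilworth≤k) =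
  proj₁ tree , proj₂ tree , λ s _ → everyCut (leafSet s) , everyCut (∁ (leafSet s))
  where
  tree : Σ (BTree (suc m)) IsDecompositionTree
  tree = decompositionTree m
  everyCut : ∀ A → expCutBool G A ≤ suc m ^ k
  everyCut = cutBound G dilworth≤k zero
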